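{- If a connected graph $G$ admits a dim-pairing resolving set, then $R_{\rm MB}(G)=R'_{\rm MB}(G)=\dim(G)$.
   Context: A set $W\subseteq V(G)$ is a resolving set of $G$ if for all distinct $x,y\in V(G)$ there is $z\in W$ with $d(x,z)\neq d(y,z)$; $\dim(G)$ is the minimum size of a resolving set. A set $A=\{\{u_1,w_1\},\ldots,\{u_k,w_k\}\}$ of $2$-subsets of $V(G)$ with $|\bigcup_{i}\{u_i,w_i\}|=2k$ is a pairing resolving set if every set $\{x_1,\ldots,x_k\}$ with $x_i\in\{u_i,w_i\}$ is a resolving set; it is a dim-pairing resolving set if moreover $k=\dim(G)$. In the Maker-Breaker resolving game, Resolver and Spoiler alternately select (without skipping) a not-yet-selected vertex; Resolver wins if at some point his vertices form a resolving set, otherwise Spoiler wins. $R_{\rm MB}(G)$ (resp. $R'_{\rm MB}(G)$) is the minimum number of moves Resolver needs to win when Resolver (resp. Spoiler) moves first, provided he has a winning strategy, and $\infty$ otherwise. -}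

module Defs where

open import Data.Nat using (ℕ; zero; suc; _≤_)
open import Data.Fin using (Fin)
open import Data.Fin.Subset using (Subset; _∈_; _∉_; _∪_; ⁅_⁆; ∣_∣; ⊥)
open import Data.Bool using (Bool; true; false)
open import Data.Product using (Σ; ∃; ∃-syntax; _×_; _,_)
open import Data.Sum using (_⊎_)
open import Relation.Binary.PropositionalEquality using (_≡_; _≢_)
open import Relation.Nullary using (¬_)
open import Level using (0ℓ) renaming (suc to lsuc)

record Graph (n : ℕ) : Set₁ where
  field
    Adj     : Fin n → Fin n → Set
    sym     : ∀ {x y} → Adj x y → Adj y x
    irrefl  : ∀ {x} → ¬ Adj x x
open Graph public

module _ {n : ℕ} (G : Graph n) where

  data Walk : Fin n → Fin n → ℕ → Set where
    [] : ∀ {x} → Walk x x zero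
    _∷_ : ∀ {x y z k} → Adj G x y → Walk y z k → Walk x z (suc k)

  Connected : Set
  Connected = ∀ x y → ∃[ k ] Walk x y k

  IsDist : Fin n → Fin n → ℕ → Set
  IsDist x y k = Walk x y k × (∀ j → Walk x y j → k ≤ j)

  Distinguishes : Fin n → Fin n → Fin n → Set
  Distinguishes z x y =
    ∃[ dx ] ∃[ dy ] (IsDist x z dx × IsDist y z dy × dx ≢ dy)

  Resolves : (Fin n → Set) → Set
  Resolves M = ∀ x y → x ≢ y → ∃[ z ] (M z × Distinguishes z x y)

  ResolvingSet : Subset n → Set
  ResolvingSet W = Resolves (_∈ W)

  IsMetricDim : ℕ → Set
  IsMetricDim k =
    (∃[ W ] (ResolvingSet W × ∣ W ∣ ≡ k)) × (∀ W → ResolvingSet W → k ≤ ∣ W ∣)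

  -- A = {{u i, w i} | i < k}, pairwise disjoint 2-subsets (2k distinct vertices),
  -- such that each choice {x_1,...,x_k}, x_i ∈ {u i, w i}, is resolving.
  pick : ∀ {k} → (Fin k → Fin n) → (Fin k → Fin n) → (Fin k → Bool) → Fin k → Fin n
  pick u w c i with c i
  ... | true = u i
  ... | false = w i

  IsPairingResolving : (k : ℕ) → (Fin k → Fin n) → (Fin k → Fin n) → Set
  IsPairingResolving k u w =
    (∀ i j → u i ≡ u j → i ≡ j) ×
    (∀ i j → w i ≡ w j → i ≡ j) ×
    (∀ i j → u i ≢ w j) ×
    (∀ (c : Fin k → Bool) → Resolves (λ z → ∃[ i ] (z ≡ pick u w c i)))

  HasDimPairingResolvingSet : Set
  HasDimPairingResolvingSet =
    ∃[ k ] (IsMetricDim k × ∃[ u ] ∃[ w ] IsPairingResolving k u w)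

  -- Maker-Breaker resolving game. R = Resolver's vertices, S = Spoiler's vertices.
  Free : Subset n → Subset n → Fin n → Set
  Free R S v = v ∉ R × v ∉ S

  -- ResolverTurn m R S : Resolver is to move and can force a win using
  --   at most m further moves of his own.
  -- SpoilerTurn m R S : Spoiler is to move and Resolver can force a win
  --   using at most m further moves of his own.
  -- Resolver wins as soon as his set is resolving; if Spoiler is to move and
  -- no vertex is free, the game is over and Resolver has lost.
  ResolverTurn : ℕ → Subset n → Subset n → Set
  SpoilerTurn  : ℕ → Subset n → Subset n → Set
  ResolverTurn zero    R S = ResolvingSet R
  ResolverTurn (suc m) R S =
    ResolvingSet R ⊎ ∃[ v ] (Free R S v × SpoilerTurn m (R ∪ ⁅ v ⁆) S)
  SpoilerTurn m R S =
    ResolvingSet R ⊎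
    ((∃[ u ] Free R S u) × (∀ u → Free R S u → ResolverTurn m R (S ∪ ⁅ u ⁆)))

  -- R_MB(G) = k (finite): Resolver moves first.
  IsRMB : ℕ → Set
  IsRMB k = ResolverTurn k ⊥ ⊥ × (∀ m → ResolverTurn m ⊥ ⊥ → k ≤ m)

  -- R'_MB(G) = k (finite): Spoiler moves first.
  IsRMB' : ℕ → Set
  IsRMB' k = SpoilerTurn k ⊥ ⊥ × (∀ m → SpoilerTurn m ⊥ ⊥ → k ≤ m)

-- Every resolving set has at least dim(G) vertices, and in either version of the game
-- Resolver claims at most one vertex per move, so he needs at least dim(G) moves.
-- Conversely, given a dim-pairing resolving set {{u i, w i}}, Resolver plays a pairing
-- strategy: whenever Spoiler takes a vertex of a still untouched pair, Resolver takes its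
-- partner, and otherwise he takes a vertex of some untouched pair. After dim(G) moves he
-- holds one vertex of every pair, which is resolving by the pairing property.
module Submission where

open import Defs hiding (sym)
open import Data.Nat using (ℕ; zero; suc; _≤_; _+_; s≤s)
open import Data.Nat.Properties using (≤-trans; ≤-refl; ≤-antisym; +-suc; m≤m+n; n≤1+n; +-monoˡ-≤)
open import Data.Fin using (Fin; punchIn; punchOut) renaming (zero to fzero; suc to fsuc)
open import Data.Fin.Properties using (punchIn-injective; punchInᵢ≢i; punchIn-punchOut; any?) renaming (_≟_ to _≟ᶠ_)
open import Data.Fin.Subset using (Subset; _∈_; _∉_; _∪_; ⁅_⁆; ∣_∣; ⊥; inside; outside)
open import Data.Fin.Subset.Properties using (_∈?_; ∉⊥; ∣⊥∣≡0; x∈⁅x⁆; x∈⁅y⁆⇒x≡y; x∈p∪q⁻; x∈p∪q⁺; ∪-identityʳ)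
open import Data.Vec using (_∷_)
open import Data.Bool using (Bool)
open import Data.Product using (∃-syntax; _×_; _,_; proj₁; proj₂)
open import Data.Sum using (_⊎_; inj₁; inj₂)
open import Data.Empty using (⊥-elim)
open import Relation.Binary.PropositionalEquality using (_≡_; _≢_; refl; sym; trans; cong; subst)
open import Relation.Nullary using (¬_; Dec; yes; no; does)
open import Relation.Nullary.Decidable using (_⊎-dec_)

∣p∪⁅x⁆∣≤1+∣p∣ : ∀ {n} (p : Subset n) (x : Fin n) → ∣ p ∪ ⁅ x ⁆ ∣ ≤ suc ∣ p ∣
∣p∪⁅x⁆∣≤1+∣p∣ (inside  ∷ p) fzero    rewrite ∪-identityʳ p = s≤s (n≤1+n ∣ p ∣)
∣p∪⁅x⁆∣≤1+∣p∣ (outside ∷ p) fzero    rewrite ∪-identityʳ p = ≤-refl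
∣p∪⁅x⁆∣≤1+∣p∣ (inside  ∷ p) (fsuc x) = s≤s (∣p∪⁅x⁆∣≤1+∣p∣ p x)
∣p∪⁅x⁆∣≤1+∣p∣ (outside ∷ p) (fsuc x) = ∣p∪⁅x⁆∣≤1+∣p∣ p x

x∉p⇒x≢y⇒x∉p∪⁅y⁆ : ∀ {n} {x y : Fin n} {p : Subset n} → x ∉ p → x ≢ y → x ∉ p ∪ ⁅ y ⁆
x∉p⇒x≢y⇒x∉p∪⁅y⁆ {y = y} {p} x∉p x≢y x∈p∪⁅y⁆ with x∈p∪q⁻ p ⁅ y ⁆ x∈p∪⁅y⁆
... | inj₁ x∈p   = x∉p x∈p
... | inj₂ x∈⁅y⁆ = x≢y (x∈⁅y⁆⇒x≡y y x∈⁅y⁆)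

y∈p∪⁅y⁆ : ∀ {n} (p : Subset n) (y : Fin n) → y ∈ p ∪ ⁅ y ⁆
y∈p∪⁅y⁆ p y = x∈p∪q⁺ (inj₂ (x∈⁅x⁆ y))

IsMetricDim-unique : ∀ {n} (G : Graph n) {k l} → IsMetricDim G k → IsMetricDim G l → k ≡ l
IsMetricDim-unique G ((W , W-res , ∣W∣≡k) , k-min) ((V , V-res , ∣V∣≡l) , l-min) =
  ≤-antisym (subst (_ ≤_) ∣V∣≡l (k-min V V-res)) (subst (_ ≤_) ∣W∣≡k (l-min W W-res))

module GameLength {n : ℕ} (G : Graph n) where

  mutual
    resolverTurn⇒resolvingSet : ∀ m R S → ResolverTurn G m R S →
                                ∃[ W ] (ResolvingSet G W × ∣ W ∣ ≤ ∣ R ∣ + m)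
    resolverTurn⇒resolvingSet zero    R S R-res        = R , R-res , m≤m+n ∣ R ∣ 0
    resolverTurn⇒resolvingSet (suc m) R S (inj₁ R-res) = R , R-res , m≤m+n ∣ R ∣ (suc m)
    resolverTurn⇒resolvingSet (suc m) R S (inj₂ (v , _ , win))
      with spoilerTurn⇒resolvingSet m (R ∪ ⁅ v ⁆) S win
    ... | W , W-res , ∣W∣≤ =
      W , W-res , ≤-trans ∣W∣≤ (subst (∣ R ∪ ⁅ v ⁆ ∣ + m ≤_) (sym (+-suc ∣ R ∣ m)) (+-monoˡ-≤ m (∣p∪⁅x⁆∣≤1+∣p∣ R v)))

    spoilerTurn⇒resolvingSet : ∀ m R S → SpoilerTurn G m R S →
                               ∃[ W ] (ResolvingSet G W × ∣ W ∣ ≤ ∣ R ∣ + m)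
    spoilerTurn⇒resolvingSet m R S (inj₁ R-res)            = R , R-res , m≤m+n ∣ R ∣ m
    spoilerTurn⇒resolvingSet m R S (inj₂ ((s , s-free) , win)) =
      resolverTurn⇒resolvingSet m R (S ∪ ⁅ s ⁆) (win s s-free)

  dim≤moves : ∀ {k m} → IsMetricDim G k → ∃[ W ] (ResolvingSet G W × ∣ W ∣ ≤ ∣ ⊥ {n} ∣ + m) → k ≤ m
  dim≤moves {m = m} (_ , k-min) (W , W-res , ∣W∣≤) =
    ≤-trans (k-min W W-res) (subst (λ b → ∣ W ∣ ≤ b + m) (∣⊥∣≡0 n) ∣W∣≤)

module PairingStrategy {n : ℕ} (G : Graph n) (k : ℕ) (u w : Fin k → Fin n)
                       (pairing : IsPairingResolving G k u w) where

  u-injective : ∀ i j → u i ≡ u j → i ≡ j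
  u-injective = proj₁ pairing

  w-injective : ∀ i j → w i ≡ w j → i ≡ j
  w-injective = proj₁ (proj₂ pairing)

  u≢w : ∀ i j → u i ≢ w j
  u≢w = proj₁ (proj₂ (proj₂ pairing))

  choices-resolve : ∀ c → Resolves G (λ z → ∃[ i ] (z ≡ pick G u w c i))
  choices-resolve = proj₂ (proj₂ (proj₂ pairing))

  OnPair : Fin n → Fin k → Set
  OnPair v i = v ≡ u i ⊎ v ≡ w i

  onPair? : ∀ v i → Dec (OnPair v i)
  onPair? v i = (v ≟ᶠ u i) ⊎-dec (v ≟ᶠ w i)

  onPair-unique : ∀ {v i j} → OnPair v i → OnPair v j → i ≡ j
  onPair-unique (inj₁ v≡ui) (inj₁ v≡uj) = u-injective _ _ (trans (sym v≡ui) v≡uj)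
  onPair-unique (inj₁ v≡ui) (inj₂ v≡wj) = ⊥-elim (u≢w _ _ (trans (sym v≡ui) v≡wj))
  onPair-unique (inj₂ v≡wi) (inj₁ v≡uj) = ⊥-elim (u≢w _ _ (trans (sym v≡uj) v≡wi))
  onPair-unique (inj₂ v≡wi) (inj₂ v≡wj) = w-injective _ _ (trans (sym v≡wi) v≡wj)

  partner : ∀ {s i} → OnPair s i → ∃[ v ] (OnPair v i × v ≢ s)
  partner {i = i} (inj₁ s≡ui) = w i , inj₂ refl , λ wi≡s → u≢w i i (trans (sym s≡ui) (sym wi≡s))
  partner {i = i} (inj₂ s≡wi) = u i , inj₁ refl , λ ui≡s → u≢w i i (trans ui≡s s≡wi)

  Claimed : Subset n → Fin k → Set
  Claimed R i = ∃[ v ] (OnPair v i × v ∈ R)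

  choiceIn : Subset n → Fin k → Bool
  choiceIn R i = does (u i ∈? R)

  pick-choiceIn∈ : ∀ R → (∀ i → Claimed R i) → ∀ i → pick G u w (choiceIn R) i ∈ R
  pick-choiceIn∈ R claimed i with u i ∈? R | claimed i
  ... | yes ui∈R | _                    = ui∈R
  ... | no ui∉R  | _ , inj₁ refl , ui∈R = ⊥-elim (ui∉R ui∈R)
  ... | no _     | _ , inj₂ refl , wi∈R = wi∈R

  claimsAllPairs⇒resolvingSet : ∀ R → (∀ i → Claimed R i) → ResolvingSet G R
  claimsAllPairs⇒resolvingSet R claimed x y x≢y
    with choices-resolve (choiceIn R) x y x≢y
  ... | z , (i , z≡) , distinguishes =
    z , subst (_∈ R) (sym z≡) (pick-choiceIn∈ R claimed i) , distinguishes

  -- `pending` lists the m pairs of which neither player holds a vertex yet.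
  record Invariant (m : ℕ) (R S : Subset n) : Set where
    field
      pending           : Fin m → Fin k
      pending-injective : ∀ p q → pending p ≡ pending q → p ≡ q
      settled           : ∀ i → (∃[ p ] pending p ≡ i) ⊎ Claimed R i
      pending-free      : ∀ p {v} → OnPair v (pending p) → Free G R S v
  open Invariant

  invariant-initial : Invariant k ⊥ ⊥
  invariant-initial = record
    { pending           = λ i → i
    ; pending-injective = λ _ _ e → e
    ; settled           = λ i → inj₁ (i , refl)
    ; pending-free      = λ _ _ → ∉⊥ , ∉⊥
    }

  invariant-final : ∀ {R S} → Invariant 0 R S → ResolvingSet G R
  invariant-final {R} I = claimsAllPairs⇒resolvingSet R λ i → claimed (settled I i)
    where
    claimed : ∀ {i} → (∃[ p ] pending I p ≡ i) ⊎ Claimed R i → Claimed R i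
    claimed (inj₂ c) = c

  invariant-claim : ∀ {m R S} (I : Invariant (suc m) R S) p {v} → OnPair v (pending I p) →
                    Invariant m (R ∪ ⁅ v ⁆) S
  invariant-claim {R = R} {S} I p {v} v-on = record
    { pending           = λ q → pending I (punchIn p q)
    ; pending-injective = λ q r e → punchIn-injective p q r (pending-injective I _ _ e)
    ; settled           = settled′
    ; pending-free      = free′
    }
    where
    settled′ : ∀ i → (∃[ q ] pending I (punchIn p q) ≡ i) ⊎ Claimed (R ∪ ⁅ v ⁆) i
    settled′ i with settled I i
    ... | inj₂ (v′ , v′-on , v′∈R) = inj₂ (v′ , v′-on , x∈p∪q⁺ (inj₁ v′∈R))
    ... | inj₁ (q , e) with p ≟ᶠ q
    ...   | yes refl = inj₂ (v , subst (OnPair v) e v-on , y∈p∪⁅y⁆ R v)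
    ...   | no p≢q   = inj₁ (punchOut p≢q , trans (cong (pending I) (punchIn-punchOut p≢q)) e)

    free′ : ∀ q {v′} → OnPair v′ (pending I (punchIn p q)) → Free G (R ∪ ⁅ v ⁆) S v′
    free′ q {v′} v′-on with pending-free I (punchIn p q) v′-on
    ... | v′∉R , v′∉S = x∉p⇒x≢y⇒x∉p∪⁅y⁆ v′∉R v′≢v , v′∉S
      where
      v′≢v : v′ ≢ v
      v′≢v refl = punchInᵢ≢i p q (pending-injective I _ _ (onPair-unique v′-on v-on))

  invariant-spoil : ∀ {m R S} (I : Invariant m R S) {s} → (∀ p → ¬ OnPair s (pending I p)) →
                    Invariant m R (S ∪ ⁅ s ⁆)
  invariant-spoil I s-off = record
    { pending           = pending I
    ; pending-injective = pending-injective I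
    ; settled           = settled I
    ; pending-free      = λ p v-on → let v∉R , v∉S = pending-free I p v-on in
        v∉R , x∉p⇒x≢y⇒x∉p∪⁅y⁆ v∉S (λ { refl → s-off p v-on })
    }

  reply : ∀ {m R S} (I : Invariant (suc m) R S) s →
          ∃[ p ] ∃[ v ] (OnPair v (pending I p) × v ≢ s × (∀ q → ¬ OnPair s (pending I (punchIn p q))))
  reply I s with any? (λ p → onPair? s (pending I p))
  ... | yes (p , s-on) = let v , v-on , v≢s = partner s-on in
    p , v , v-on , v≢s ,
    λ q s-on′ → punchInᵢ≢i p q (pending-injective I _ _ (onPair-unique s-on′ s-on))
  ... | no s-off =
    fzero , u (pending I fzero) , inj₁ refl ,
    (λ { refl → s-off (fzero , inj₁ refl) }) , λ q s-on → s-off (_ , s-on)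

  mutual
    invariant⇒resolverTurn : ∀ {m R S} → Invariant m R S → ResolverTurn G m R S
    invariant⇒resolverTurn {zero}  I = invariant-final I
    invariant⇒resolverTurn {suc m} I =
      inj₂ (u (pending I fzero) , pending-free I fzero (inj₁ refl) ,
            invariant⇒spoilerTurn (invariant-claim I fzero (inj₁ refl)))

    invariant⇒spoilerTurn : ∀ {m R S} → Invariant m R S → SpoilerTurn G m R S
    invariant⇒spoilerTurn {zero}          I = inj₁ (invariant-final I)
    invariant⇒spoilerTurn {suc m} {R} {S} I =
      inj₂ ((u (pending I fzero) , pending-free I fzero (inj₁ refl)) , answer)
      where
      answer : ∀ s → Free G R S s → ResolverTurn G (suc m) R (S ∪ ⁅ s ⁆)
      answer s _ with reply I s
      ... | p , v , v-on , v≢s , s-off =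
        let v∉R , v∉S = pending-free I p v-on in
        inj₂ (v , (v∉R , x∉p⇒x≢y⇒x∉p∪⁅y⁆ v∉S v≢s) ,
              invariant⇒spoilerTurn (invariant-spoil (invariant-claim I p v-on) s-off))

corollary3p4 : (n : ℕ) (G : Graph n) → Connected G → HasDimPairingResolvingSet G →
    (k : ℕ) → IsMetricDim G k → IsRMB G k × IsRMB' G k
corollary3p4 n G _ (l , l-dim , u , w , pairing) k k-dim =
  (resolverWins , λ m win → dim≤moves k-dim (resolverTurn⇒resolvingSet m ⊥ ⊥ win)) ,
  (spoilerLoses , λ m win → dim≤moves k-dim (spoilerTurn⇒resolvingSet m ⊥ ⊥ win))
  where
  open GameLength G
  open PairingStrategy G l u w pairing

  l≡k : l ≡ k
  l≡k = IsMetricDim-unique G l-dim k-dim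

  resolverWins : ResolverTurn G k ⊥ ⊥
  resolverWins = subst (λ t → ResolverTurn G t ⊥ ⊥) l≡k (invariant⇒resolverTurn invariant-initial)

  spoilerLoses : SpoilerTurn G k ⊥ ⊥
  spoilerLoses = subst (λ t → SpoilerTurn G t ⊥ ⊥) l≡k (invariant⇒spoilerTurn invariant-initial)
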